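{- Let $k\ge 1$ and let $T$ be a tournament with a transitive edge coloring with colors $1,\dots,k$. Then $$encl(T)\le \sum_{I\subseteq[k]} dom(T_I),$$ where $T_I$ is the scrambling of $T$ obtained by reversing all edges of color $i$ for every $i\in I$. Consequently $r(k)\le \max_T\sum_{I\subseteq [k]}dom(T_I)$, the maximum over all transitively $k$-colored tournaments $T$.
   Context: An edge coloring of a tournament $T$ with colors $1,\dots,k$ is transitive if for each $i$ the digraph $T(i)$ formed by the edges of color $i$ is transitive (whenever $ab,bc$ are edges of $T(i)$, so is $ac$). For $I\subseteq[k]$, the scrambling $T_I$ is the tournament obtained by replacing $T(i)$ by its reverse for all $i\in I$ (it is again transitively $k$-colored). $dom(T)$ is the minimum size of a set $S$ of vertices such that every vertex $v\notin S$ has an in-neighbour in $S$ (i.e. some $w\in S$ with $wv\in E(T)$). For a transitively $k$-colored tournament $T$, a set $S\subseteq V(T)$ is an enclosure set if for every $b\in V(T)\setminus S$ there are a color $i$ and $a,c\in S$ with $ab,bc\in E(T(i))$; $encl(T)$ is the minimum size of an enclosure set. $r(k)$ denotes the supremum of $encl(T)$ over all transitively $k$-colored tournaments $T$. -}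

module Defs where

open import Data.Nat using (ℕ; zero; suc; _+_; _≤_)
open import Data.Bool using (Bool; true; false; if_then_else_)
open import Data.Fin using (Fin)
open import Data.Fin.Subset using (Subset; _∈_; _∉_; ∣_∣; inside; outside)
open import Data.Vec using (Vec; []; _∷_; lookup)
open import Data.Product using (Σ; ∃; _×_; _,_)
open import Data.Sum using (_⊎_)
open import Relation.Binary.PropositionalEquality using (_≡_)

-- E a b ≡ true  means the edge a → b is present.
-- col a b is the colour of the pair {a,b} (symmetric); only meaningful for a ≢ b.
record TransColTournament (n k : ℕ) : Set where
  field
    E         : Fin n → Fin n → Bool
    irrefl    : ∀ a → E a a ≡ false
    total     : ∀ a b → a ≡ b ⊎ (E a b ≡ true ⊎ E b a ≡ true)
    antisym   : ∀ a b → E a b ≡ true → E b a ≡ false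
    col       : Fin n → Fin n → Fin k
    col-sym   : ∀ a b → col a b ≡ col b a
    trans-col : ∀ (i : Fin k) a b c →
                E a b ≡ true → col a b ≡ i →
                E b c ≡ true → col b c ≡ i →
                E a c ≡ true × col a c ≡ i

open TransColTournament public

scrambleE : ∀ {n k} → TransColTournament n k → Subset k → Fin n → Fin n → Bool
scrambleE T I a b = if lookup I (col T a b) then E T b a else E T a b

IsDominating : ∀ {n} → (Fin n → Fin n → Bool) → Subset n → Set
IsDominating R S = ∀ v → v ∉ S → Σ _ λ w → w ∈ S × R w v ≡ true

IsEnclosure : ∀ {n k} → TransColTournament n k → Subset n → Set
IsEnclosure T S = ∀ b → b ∉ S → Σ (Fin _) λ i → Σ _ λ a → Σ _ λ c →
  a ∈ S × c ∈ S × (E T a b ≡ true × col T a b ≡ i) × (E T b c ≡ true × col T b c ≡ i)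

IsMinSize : ∀ {n} → (Subset n → Set) → ℕ → Set
IsMinSize P m = (Σ _ λ S → P S × ∣ S ∣ ≡ m) × (∀ S → P S → m ≤ ∣ S ∣)

IsDom : ∀ {n} → (Fin n → Fin n → Bool) → ℕ → Set
IsDom R d = IsMinSize (IsDominating R) d

IsEncl : ∀ {n k} → TransColTournament n k → ℕ → Set
IsEncl T e = IsMinSize (IsEnclosure T) e

sumSubsets : (k : ℕ) → (Subset k → ℕ) → ℕ
sumSubsets zero f = f []
sumSubsets (suc k) f = sumSubsets k (λ I → f (outside ∷ I)) + sumSubsets k (λ I → f (inside ∷ I))

-- The union S of minimum dominating sets of all 2^k scramblings is an enclosure set.
-- For b ∉ S let I be the set of colours of edges entering b from S, and let w ∈ S
-- dominate b in T_I: then wb must be a reversed edge, so b → w in T with colour i ∈ I,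
-- and by the choice of I some a ∈ S has a → b in colour i.  Hence encl(T) ≤ |S| ≤ Σ_I dom(T_I).
module Submission where

open import Defs
open import Data.Nat using (ℕ; zero; suc; _+_; _≤_; z≤n; s≤s)
open import Data.Nat.Properties using (≤-refl; ≤-trans; ≤-reflexive; +-mono-≤; +-suc; n≤1+n)
open import Data.Fin using (Fin)
open import Data.Fin.Properties using (any?) renaming (_≟_ to _≟ᶠ_)
open import Data.Fin.Subset using (Subset; _∈_; _∉_; _⊆_; _∪_; ∣_∣; inside; outside)
open import Data.Fin.Subset.Properties using (_∈?_; p⊆p∪q; q⊆p∪q)
open import Data.Bool using (Bool; true)
open import Data.Bool.Properties using () renaming (_≟_ to _≟ᵇ_)
open import Data.Vec using ([]; _∷_; lookup; tabulate)
open import Data.Vec.Properties using (lookup∘tabulate)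
open import Data.Product using (∃; _×_; _,_; proj₁; proj₂)
open import Data.Empty using (⊥-elim)
open import Function using (_∘_)
open import Relation.Nullary using (Dec; yes; no; does)
open import Relation.Nullary.Decidable using (_×-dec_)
open import Relation.Binary.PropositionalEquality using (_≡_; refl; sym)

∣p∪q∣≤∣p∣+∣q∣ : ∀ {n} (p q : Subset n) → ∣ p ∪ q ∣ ≤ ∣ p ∣ + ∣ q ∣
∣p∪q∣≤∣p∣+∣q∣ []            []            = z≤n
∣p∪q∣≤∣p∣+∣q∣ (outside ∷ p) (outside ∷ q) = ∣p∪q∣≤∣p∣+∣q∣ p q
∣p∪q∣≤∣p∣+∣q∣ (inside  ∷ p) (outside ∷ q) = s≤s (∣p∪q∣≤∣p∣+∣q∣ p q)
∣p∪q∣≤∣p∣+∣q∣ (outside ∷ p) (inside  ∷ q) =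
  ≤-trans (s≤s (∣p∪q∣≤∣p∣+∣q∣ p q)) (≤-reflexive (sym (+-suc ∣ p ∣ ∣ q ∣)))
∣p∪q∣≤∣p∣+∣q∣ (inside  ∷ p) (inside  ∷ q) =
  s≤s (≤-trans (∣p∪q∣≤∣p∣+∣q∣ p q) (≤-trans (n≤1+n _) (≤-reflexive (sym (+-suc ∣ p ∣ ∣ q ∣)))))

sumSubsets-mono : ∀ k {f g : Subset k → ℕ} → (∀ I → f I ≤ g I) → sumSubsets k f ≤ sumSubsets k g
sumSubsets-mono zero    f≤g = f≤g []
sumSubsets-mono (suc k) f≤g =
  +-mono-≤ (sumSubsets-mono k (f≤g ∘ (outside ∷_))) (sumSubsets-mono k (f≤g ∘ (inside ∷_)))

⋃Subsets : ∀ {n} k → (Subset k → Subset n) → Subset n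
⋃Subsets zero    f = f []
⋃Subsets (suc k) f = ⋃Subsets k (f ∘ (outside ∷_)) ∪ ⋃Subsets k (f ∘ (inside ∷_))

⊆-⋃Subsets : ∀ {n} k (f : Subset k → Subset n) I → f I ⊆ ⋃Subsets k f
⊆-⋃Subsets zero    f []            = λ x∈ → x∈
⊆-⋃Subsets (suc k) f (outside ∷ I) =
  p⊆p∪q (⋃Subsets k (f ∘ (inside ∷_))) ∘ ⊆-⋃Subsets k (f ∘ (outside ∷_)) I
⊆-⋃Subsets (suc k) f (inside ∷ I)  =
  q⊆p∪q (⋃Subsets k (f ∘ (outside ∷_))) _ ∘ ⊆-⋃Subsets k (f ∘ (inside ∷_)) I

∣⋃Subsets∣≤sumSubsets : ∀ {n} k (f : Subset k → Subset n) → ∣ ⋃Subsets k f ∣ ≤ sumSubsets k (∣_∣ ∘ f)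
∣⋃Subsets∣≤sumSubsets zero    f = ≤-refl
∣⋃Subsets∣≤sumSubsets (suc k) f =
  ≤-trans (∣p∪q∣≤∣p∣+∣q∣ (⋃Subsets k (f ∘ (outside ∷_))) (⋃Subsets k (f ∘ (inside ∷_))))
          (+-mono-≤ (∣⋃Subsets∣≤sumSubsets k _) (∣⋃Subsets∣≤sumSubsets k _))

IsDominating-⊆ : ∀ {n} {R : Fin n → Fin n → Bool} {S S′ : Subset n} →
                 S ⊆ S′ → IsDominating R S → IsDominating R S′
IsDominating-⊆ S⊆S′ dom v v∉S′ with dom v (v∉S′ ∘ S⊆S′)
... | w , w∈S , w→v = w , S⊆S′ w∈S , w→v

module _ {n k} (T : TransColTournament n k) (S : Subset n) where

  HasInNeighbourOfColour : Fin n → Fin k → Set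
  HasInNeighbourOfColour b i = ∃ λ a → a ∈ S × E T a b ≡ true × col T a b ≡ i

  hasInNeighbourOfColour? : ∀ b i → Dec (HasInNeighbourOfColour b i)
  hasInNeighbourOfColour? b i =
    any? (λ a → (a ∈? S) ×-dec ((E T a b ≟ᵇ true) ×-dec (col T a b ≟ᶠ i)))

  inColours : Fin n → Subset k
  inColours b = tabulate (does ∘ hasInNeighbourOfColour? b)

  dominatingAllScramblings⇒isEnclosure : (∀ I → IsDominating (scrambleE T I) S) → IsEnclosure T S
  dominatingAllScramblings⇒isEnclosure dom b b∉S
    with dom (inColours b) b b∉S
  ... | w , w∈S , w→b
    rewrite lookup∘tabulate (does ∘ hasInNeighbourOfColour? b) (col T w b)
    with hasInNeighbourOfColour? b (col T w b)
  ...   | yes (a , a∈S , a→b , colab) = col T w b , a , w , a∈S , w∈S , (a→b , colab) , (w→b , col-sym T b w)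
  ...   | no noInNeighbour            = ⊥-elim (noInNeighbour (w , w∈S , w→b , refl))

theorem1p4 : (k n : ℕ) → 1 ≤ k → (T : TransColTournament n k)
    → (d : Subset k → ℕ) → (∀ I → IsDom (scrambleE T I) (d I))
    → (e : ℕ) → IsEncl T e
    → e ≤ sumSubsets k d
theorem1p4 k n _ T d isDom e (_ , encl-minimal) =
  ≤-trans (encl-minimal S (dominatingAllScramblings⇒isEnclosure T S dominatesAll))
          (≤-trans (∣⋃Subsets∣≤sumSubsets k D) (sumSubsets-mono k (≤-reflexive ∘ ∣D∣≡d)))
  where
    D : Subset k → Subset n
    D I = proj₁ (proj₁ (isDom I))

    ∣D∣≡d : ∀ I → ∣ D I ∣ ≡ d I
    ∣D∣≡d I = proj₂ (proj₂ (proj₁ (isDom I)))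

    S : Subset n
    S = ⋃Subsets k D

    dominatesAll : ∀ I → IsDominating (scrambleE T I) S
    dominatesAll I = IsDominating-⊆ (⊆-⋃Subsets k D I) (proj₁ (proj₂ (proj₁ (isDom I))))
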